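{- Let $k\ge1$ be an integer. If $G$ is a $\delta$-regular finite simple graph of order $n$ with complement $\overline{G}$, then $$d_R^k(G)+d_R^k(\overline{G})\le \max\{4k-2,\ n+2k-1,\ n+3k-2-\delta,\ 3k+\delta-1\}.$$
   Context: Let $k\ge1$ be an integer. A Roman $k$-dominating function (RkDF) on a graph $G$ is a map $f:V(G)\to\{0,1,2\}$ such that every vertex $v$ with $f(v)=0$ has at least $k$ neighbors $u$ with $f(u)=2$. A set $\{f_1,\ldots,f_d\}$ of pairwise distinct RkDFs on $G$ with $\sum_{i=1}^d f_i(v)\le 2k$ for every $v\in V(G)$ is a Roman $(k,k)$-dominating family on $G$; the maximum number of functions in such a family is the Roman $(k,k)$-domatic number $d_R^k(G)$. -}

module Defs where

open import Data.Nat using (ℕ; zero; suc; _+_; _*_; _∸_; _≤_; _⊔_)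
open import Data.Fin using (Fin; zero; suc; toℕ)
open import Data.Fin.Properties using (_≟_)
open import Data.Bool using (Bool; true; false; not; _∧_; if_then_else_)
open import Data.Bool.Properties using (∧-zeroʳ)
open import Data.Empty using (⊥-elim)
open import Data.List using (List; []; _∷_; length)
open import Data.List.Relation.Unary.All using (All)
open import Data.List.Relation.Unary.AllPairs using (AllPairs)
open import Relation.Binary.PropositionalEquality using (_≡_; refl; sym; cong)
open import Relation.Nullary using (¬_; does; yes; no)

count : ∀ {n} → (Fin n → Bool) → ℕ
count {zero} p = 0
count {suc n} p = (if p zero then 1 else 0) + count {n} (λ i → p (suc i))

record Graph (n : ℕ) : Set where
  field
    adj      : Fin n → Fin n → Bool
    adj-sym  : ∀ u v → adj u v ≡ adj v u
    loopless : ∀ v → adj v v ≡ false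
open Graph public

degree : ∀ {n} → Graph n → Fin n → ℕ
degree G v = count (adj G v)

Regular : ∀ {n} → Graph n → ℕ → Set
Regular G δ = ∀ v → degree G v ≡ δ

private
  neq : ∀ {n} → Fin n → Fin n → Bool
  neq u v = not (does (u ≟ v))

  neq-sym : ∀ {n} (u v : Fin n) → neq u v ≡ neq v u
  neq-sym u v with u ≟ v | v ≟ u
  ... | yes _ | yes _ = refl
  ... | yes p | no q = ⊥-elim (q (sym p))
  ... | no q | yes p = ⊥-elim (q (sym p))
  ... | no _ | no _ = refl

  neq-refl : ∀ {n} (v : Fin n) → neq v v ≡ false
  neq-refl v with v ≟ v
  ... | yes _ = refl
  ... | no q = ⊥-elim (q refl)

complement : ∀ {n} → Graph n → Graph n
complement G = record
  { adj = λ u v → not (adj G u v) ∧ neq u v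
  ; adj-sym = λ u v → helper u v
  ; loopless = λ v → subst' v }
  where
  helper : ∀ u v → (not (adj G u v) ∧ neq u v) ≡ (not (adj G v u) ∧ neq v u)
  helper u v rewrite adj-sym G u v | neq-sym u v = refl
  subst' : ∀ v → (not (adj G v v) ∧ neq v v) ≡ false
  subst' v rewrite neq-refl v = ∧-zeroʳ (not (adj G v v))

is2 : Fin 3 → Bool
is2 (suc (suc zero)) = true
is2 _ = false

RkDF : ∀ {n} → ℕ → Graph n → (Fin n → Fin 3) → Set
RkDF k G f = ∀ v → f v ≡ zero → k ≤ count (λ u → adj G v u ∧ is2 (f u))

sumAt : ∀ {n} → List (Fin n → Fin 3) → Fin n → ℕ
sumAt [] v = 0
sumAt (f ∷ fs) v = toℕ (f v) + sumAt fs v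

Distinct : ∀ {n} → (Fin n → Fin 3) → (Fin n → Fin 3) → Set
Distinct f g = ¬ (∀ v → f v ≡ g v)

record RkkFamily {n} (k : ℕ) (G : Graph n) (fs : List (Fin n → Fin 3)) : Set where
  field
    each-RkDF : All (RkDF k G) fs
    distinct  : AllPairs Distinct fs
    bounded   : ∀ v → sumAt fs v ≤ 2 * k

-- d_R^k(G) ≤ m  expressed as: every Roman (k,k)-dominating family has at most m members.
-- The sum bound d_R^k(G) + d_R^k(Ḡ) ≤ M is stated via all pairs of families.

module Submission where

-- Let G be δ-regular on n ≥ 1 vertices and f₁ … f_d a
-- Roman (k,k)-dominating family on G.  We show  d ≤ max (2k − 1) (k + δ).
--  * If k ≤ δ, every RkDF f has weight w(f) = Σ_v f(v) with 2kn ≤ (k+δ)·w(f):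
--    with Z, T the numbers of vertices labelled 0 and 2, double counting the
--    edges from 0-vertices to 2-vertices gives kZ ≤ δT, and summing the
--    pointwise inequality 2k + 2δ[x=2] ≤ (k+δ)x + 2k[x=0] over V gives
--    2kn + 2δT ≤ (k+δ)w(f) + 2kZ.  Summing over the family,
--    d·2kn ≤ (k+δ)·Σ_v Σ_i f_i(v) ≤ (k+δ)·2kn, hence d ≤ k + δ.
--  * If δ < k, no vertex can be labelled 0, so Σ_i f_i(v) ≥ d at every v; if
--    d ≥ 2k, every f_i is then constantly 1, contradicting distinctness.
-- The complement of G is (n−1−δ)-regular, and adding the two bounds and
-- expanding the maximum of a sum gives the theorem.  For n = 0 all labellings
-- coincide, so each family has at most one member.

open import Defs
open import Data.Nat using (ℕ; zero; suc; _+_; _*_; _∸_; _≤_; _<_; _⊔_; z≤n; s≤s)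
open import Data.Nat.Properties hiding (_≟_)
open import Data.Fin using (Fin; zero; suc; toℕ)
open import Data.Fin.Properties using (_≟_)
open import Data.Bool using (Bool; true; false; _∧_; if_then_else_)
open import Data.List using (List; []; _∷_; length)
open import Data.List.Relation.Unary.All using (All; []; _∷_)
open import Data.List.Relation.Unary.AllPairs using (AllPairs; []; _∷_)
open import Data.Empty using (⊥-elim)
open import Function using (_∘_)
open import Relation.Binary.PropositionalEquality
open import Relation.Nullary using (does; yes; no)
open import Data.Nat.Tactic.RingSolver using (solve-∀)
open import Algebra.Properties.Semiring.Sum +-*-semiring
  using (sum; sum-cong-≗; ∑-distrib-+; ∑-comm; *-distribˡ-sum)

⟦_⟧ : Bool → ℕ
⟦ b ⟧ = if b then 1 else 0

⟦∧⟧ : ∀ a b → ⟦ a ∧ b ⟧ ≡ ⟦ b ⟧ * ⟦ a ⟧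
⟦∧⟧ false false = refl
⟦∧⟧ false true  = refl
⟦∧⟧ true  b     = sym (*-identityʳ ⟦ b ⟧)

⟦∧⟧-≤ : ∀ a b → ⟦ a ∧ b ⟧ ≤ ⟦ a ⟧
⟦∧⟧-≤ false b     = z≤n
⟦∧⟧-≤ true  false = z≤n
⟦∧⟧-≤ true  true  = ≤-refl

count≡sum : ∀ {n} (p : Fin n → Bool) → count p ≡ sum (λ i → ⟦ p i ⟧)
count≡sum {zero}  p = refl
count≡sum {suc n} p = cong (⟦ p zero ⟧ +_) (count≡sum (p ∘ suc))

sum-mono : ∀ {n} {f g : Fin n → ℕ} → (∀ i → f i ≤ g i) → sum f ≤ sum g
sum-mono {zero}  f≤g = z≤n
sum-mono {suc n} f≤g = +-mono-≤ (f≤g zero) (sum-mono (f≤g ∘ suc))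

sum-const : ∀ {n} (c : ℕ) → sum {n} (λ _ → c) ≡ n * c
sum-const {zero}  c = refl
sum-const {suc n} c = cong (c +_) (sum-const {n} c)

sum-linear : ∀ {n} (a b : ℕ) (g h : Fin n → ℕ) →
  sum (λ i → a * g i + b * h i) ≡ a * sum g + b * sum h
sum-linear a b g h = trans (∑-distrib-+ (λ i → a * g i) (λ i → b * h i))
  (sym (cong₂ _+_ (*-distribˡ-sum a g) (*-distribˡ-sum b h)))

count-∧ : ∀ {n} (p q : Fin n → Bool) → count (λ u → p u ∧ q u) ≤ count p
count-∧ p q = subst₂ _≤_ (sym (count≡sum (λ u → p u ∧ q u))) (sym (count≡sum p))
                (sum-mono (λ u → ⟦∧⟧-≤ (p u) (q u)))

-- Double counting of edges

-- Σ_v #{u ∼ v : Q u} = Σ_u [Q u]·deg(u): both sides count the pairs (v, u)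
-- with u ∼ v and Q u, grouped by v resp. by u.
neighbour-count-sum : ∀ {n} (G : Graph n) (Q : Fin n → Bool) →
  sum (λ v → count (λ u → adj G v u ∧ Q u)) ≡ sum (λ u → ⟦ Q u ⟧ * degree G u)
neighbour-count-sum G Q = begin
  sum (λ v → count (λ u → adj G v u ∧ Q u))
    ≡⟨ sum-cong-≗ (λ v → count≡sum (λ u → adj G v u ∧ Q u)) ⟩
  sum (λ v → sum (λ u → ⟦ adj G v u ∧ Q u ⟧))
    ≡⟨ sum-cong-≗ (λ v → sum-cong-≗ (λ u → swap-edge v u)) ⟩
  sum (λ v → sum (λ u → ⟦ Q u ⟧ * ⟦ adj G u v ⟧))
    ≡⟨ ∑-comm (λ v u → ⟦ Q u ⟧ * ⟦ adj G u v ⟧) ⟩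
  sum (λ u → sum (λ v → ⟦ Q u ⟧ * ⟦ adj G u v ⟧))
    ≡⟨ sum-cong-≗ (λ u → sym (*-distribˡ-sum ⟦ Q u ⟧ (λ v → ⟦ adj G u v ⟧))) ⟩
  sum (λ u → ⟦ Q u ⟧ * sum (λ v → ⟦ adj G u v ⟧))
    ≡⟨ sum-cong-≗ (λ u → cong (⟦ Q u ⟧ *_) (sym (count≡sum (adj G u)))) ⟩
  sum (λ u → ⟦ Q u ⟧ * degree G u) ∎
  where
  open ≡-Reasoning
  swap-edge : ∀ v u → ⟦ adj G v u ∧ Q u ⟧ ≡ ⟦ Q u ⟧ * ⟦ adj G u v ⟧
  swap-edge v u = trans (⟦∧⟧ (adj G v u) (Q u)) (cong (λ b → ⟦ Q u ⟧ * ⟦ b ⟧) (adj-sym G v u))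

neighbour-count-regular : ∀ {n} (G : Graph n) (δ : ℕ) → Regular G δ → (Q : Fin n → Bool) →
  sum (λ v → count (λ u → adj G v u ∧ Q u)) ≡ δ * count Q
neighbour-count-regular G δ reg Q = begin
  sum (λ v → count (λ u → adj G v u ∧ Q u)) ≡⟨ neighbour-count-sum G Q ⟩
  sum (λ u → ⟦ Q u ⟧ * degree G u)          ≡⟨ sum-cong-≗ (λ u → trans (cong (⟦ Q u ⟧ *_) (reg u)) (*-comm ⟦ Q u ⟧ δ)) ⟩
  sum (λ u → δ * ⟦ Q u ⟧)                   ≡⟨ sym (*-distribˡ-sum δ (λ u → ⟦ Q u ⟧)) ⟩
  δ * sum (λ u → ⟦ Q u ⟧)                   ≡⟨ cong (δ *_) (sym (count≡sum Q)) ⟩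
  δ * count Q ∎
  where open ≡-Reasoning

count-false : ∀ n → count {n} (λ _ → false) ≡ 0
count-false zero    = refl
count-false (suc n) = count-false n

count-singleton : ∀ {n} (v : Fin n) → count (λ u → does (v ≟ u)) ≡ 1
count-singleton {suc n} zero    = cong suc (count-false n)
count-singleton {suc n} (suc w) = count-singleton w

-- every vertex u is exactly one of: a non-neighbour ≠ v, a neighbour, or v itself
complement-degree : ∀ {n} (G : Graph n) (v : Fin n) →
  degree (complement G) v + (degree G v + 1) ≡ n
complement-degree {n} G v = begin
  count nonAdj + (count (adj G v) + 1)
    ≡⟨ cong (λ m → count nonAdj + (count (adj G v) + m)) (sym (count-singleton v)) ⟩
  count nonAdj + (count (adj G v) + count isV)
    ≡⟨ cong₂ _+_ (count≡sum nonAdj) (cong₂ _+_ (count≡sum (adj G v)) (count≡sum isV)) ⟩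
  sum (λ u → ⟦ nonAdj u ⟧) + (sum (λ u → ⟦ adj G v u ⟧) + sum (λ u → ⟦ isV u ⟧))
    ≡⟨ cong (sum (λ u → ⟦ nonAdj u ⟧) +_) (sym (∑-distrib-+ (λ u → ⟦ adj G v u ⟧) (λ u → ⟦ isV u ⟧))) ⟩
  sum (λ u → ⟦ nonAdj u ⟧) + sum (λ u → ⟦ adj G v u ⟧ + ⟦ isV u ⟧)
    ≡⟨ sym (∑-distrib-+ (λ u → ⟦ nonAdj u ⟧) (λ u → ⟦ adj G v u ⟧ + ⟦ isV u ⟧)) ⟩
  sum (λ u → ⟦ nonAdj u ⟧ + (⟦ adj G v u ⟧ + ⟦ isV u ⟧))
    ≡⟨ sum-cong-≗ trichotomy ⟩
  sum {n} (λ _ → 1)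
    ≡⟨ trans (sum-const {n} 1) (*-identityʳ n) ⟩
  n ∎
  where
  open ≡-Reasoning
  isV nonAdj : Fin n → Bool
  isV u = does (v ≟ u)
  nonAdj = adj (complement G) v
  trichotomy : ∀ u → ⟦ nonAdj u ⟧ + (⟦ adj G v u ⟧ + ⟦ isV u ⟧) ≡ 1
  trichotomy u with v ≟ u
  ... | yes refl rewrite loopless G v = refl
  ... | no _ with adj G v u
  ...   | true  = refl
  ...   | false = refl

complement-regular : ∀ {n} (G : Graph n) (δ : ℕ) → Regular G δ →
  Regular (complement G) (n ∸ (δ + 1))
complement-regular {n} G δ reg v = begin
  degree (complement G) v                          ≡⟨ sym (m+n∸n≡m _ (δ + 1)) ⟩
  degree (complement G) v + (δ + 1) ∸ (δ + 1)      ≡⟨ cong (λ d → degree (complement G) v + (d + 1) ∸ (δ + 1)) (sym (reg v)) ⟩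
  degree (complement G) v + (degree G v + 1) ∸ (δ + 1) ≡⟨ cong (_∸ (δ + 1)) (complement-degree G v) ⟩
  n ∸ (δ + 1) ∎
  where open ≡-Reasoning

-- for a δ-regular graph of order n ≥ 1 (evaluated at any vertex, here the
-- first) the complementary degree n ∸ (δ + 1) really is n − 1 − δ
regular-order : ∀ {n} (G : Graph (suc n)) (δ : ℕ) → Regular G δ →
  suc n ≡ (suc n ∸ (δ + 1)) + (δ + 1)
regular-order G δ reg = begin
  suc _                                          ≡⟨ sym (complement-degree G zero) ⟩
  degree (complement G) zero + (degree G zero + 1) ≡⟨ cong₂ (λ a b → a + (b + 1)) (complement-regular G δ reg zero) (reg zero) ⟩
  (suc _ ∸ (δ + 1)) + (δ + 1) ∎
  where open ≡-Reasoning

-- The case k ≤ δ: a weight bound for single Roman k-dominating functions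

is0 : Fin 3 → Bool
is0 zero    = true
is0 (suc _) = false

weight : ∀ {n} → (Fin n → Fin 3) → ℕ
weight f = sum (λ v → toℕ (f v))

-- k·#{v : f v = 0} ≤ δ·#{v : f v = 2}: each 0-vertex sees k vertices labelled 2,
-- and each 2-vertex is seen by at most δ vertices
zeros-vs-twos : ∀ {n} (k δ : ℕ) (G : Graph n) → Regular G δ → (f : Fin n → Fin 3) →
  RkDF k G f → k * count (is0 ∘ f) ≤ δ * count (is2 ∘ f)
zeros-vs-twos k δ G reg f rf = begin
  k * count (is0 ∘ f)                           ≡⟨ cong (k *_) (count≡sum (is0 ∘ f)) ⟩
  k * sum (λ v → ⟦ is0 (f v) ⟧)                 ≡⟨ *-distribˡ-sum k (λ v → ⟦ is0 (f v) ⟧) ⟩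
  sum (λ v → k * ⟦ is0 (f v) ⟧)                 ≤⟨ sum-mono dominated ⟩
  sum (λ v → count (λ u → adj G v u ∧ is2 (f u))) ≡⟨ neighbour-count-regular G δ reg (is2 ∘ f) ⟩
  δ * count (is2 ∘ f) ∎
  where
  open ≤-Reasoning
  dominated : ∀ v → k * ⟦ is0 (f v) ⟧ ≤ count (λ u → adj G v u ∧ is2 (f u))
  dominated v with f v in eq
  ... | zero  = subst (_≤ _) (sym (*-identityʳ k)) (rf v eq)
  ... | suc _ = subst (_≤ count (λ u → adj G v u ∧ is2 (f u))) (sym (*-zeroʳ k)) z≤n

-- the pointwise inequality behind the weight bound, for labels x ∈ {0, 1, 2}
label-inequality : ∀ (k δ : ℕ) → k ≤ δ → ∀ x →
  2 * k * 1 + 2 * δ * ⟦ is2 x ⟧ ≤ (k + δ) * toℕ x + 2 * k * ⟦ is0 x ⟧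
label-inequality k δ k≤δ zero             = ≤-reflexive (at0 k δ)
  where at0 : ∀ k δ → 2 * k * 1 + 2 * δ * 0 ≡ (k + δ) * 0 + 2 * k * 1
        at0 = solve-∀
label-inequality k δ k≤δ (suc zero)       = subst₂ _≤_ (at1ˡ k δ) (at1ʳ k δ) (+-monoʳ-≤ k k≤δ)
  where at1ˡ : ∀ k δ → k + k ≡ 2 * k * 1 + 2 * δ * 0
        at1ˡ = solve-∀
        at1ʳ : ∀ k δ → k + δ ≡ (k + δ) * 1 + 2 * k * 0
        at1ʳ = solve-∀
label-inequality k δ k≤δ (suc (suc zero)) = ≤-reflexive (at2 k δ)
  where at2 : ∀ k δ → 2 * k * 1 + 2 * δ * 1 ≡ (k + δ) * 2 + 2 * k * 0
        at2 = solve-∀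

weight-bound : ∀ {n} (k δ : ℕ) (G : Graph n) → Regular G δ → k ≤ δ →
  (f : Fin n → Fin 3) → RkDF k G f → n * (2 * k) ≤ (k + δ) * weight f
weight-bound {n} k δ G reg k≤δ f rf = +-cancelʳ-≤ (2 * δ * T) _ _ (begin
  n * (2 * k) + 2 * δ * T
    ≡⟨ cong₂ _+_ order (cong (2 * δ *_) (count≡sum (is2 ∘ f))) ⟩
  2 * k * sum {n} (λ _ → 1) + 2 * δ * sum (λ v → ⟦ is2 (f v) ⟧)
    ≡⟨ sym (sum-linear (2 * k) (2 * δ) (λ _ → 1) (λ v → ⟦ is2 (f v) ⟧)) ⟩
  sum (λ v → 2 * k * 1 + 2 * δ * ⟦ is2 (f v) ⟧)
    ≤⟨ sum-mono (λ v → label-inequality k δ k≤δ (f v)) ⟩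
  sum (λ v → (k + δ) * toℕ (f v) + 2 * k * ⟦ is0 (f v) ⟧)
    ≡⟨ sum-linear (k + δ) (2 * k) (λ v → toℕ (f v)) (λ v → ⟦ is0 (f v) ⟧) ⟩
  (k + δ) * weight f + 2 * k * sum (λ v → ⟦ is0 (f v) ⟧)
    ≡⟨ cong (λ z → (k + δ) * weight f + 2 * k * z) (sym (count≡sum (is0 ∘ f))) ⟩
  (k + δ) * weight f + 2 * k * Z
    ≤⟨ +-monoʳ-≤ ((k + δ) * weight f) zeros≤twos ⟩
  (k + δ) * weight f + 2 * δ * T ∎)
  where
  open ≤-Reasoning
  Z T : ℕ
  Z = count (is0 ∘ f)
  T = count (is2 ∘ f)
  order : n * (2 * k) ≡ 2 * k * sum {n} (λ _ → 1)
  order = trans (*-comm n (2 * k)) (cong (2 * k *_) (sym (trans (sum-const {n} 1) (*-identityʳ n))))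
  zeros≤twos : 2 * k * Z ≤ 2 * δ * T
  zeros≤twos = subst₂ _≤_ (sym (*-assoc 2 k Z)) (sym (*-assoc 2 δ T))
    (*-monoʳ-≤ 2 (zeros-vs-twos k δ G reg f rf))

family-weight : ∀ {n} (k δ : ℕ) (G : Graph n) → Regular G δ → k ≤ δ →
  (fs : List (Fin n → Fin 3)) → All (RkDF k G) fs →
  length fs * (n * (2 * k)) ≤ (k + δ) * sum (sumAt fs)
family-weight k δ G reg k≤δ []       []        = z≤n
family-weight {n} k δ G reg k≤δ (f ∷ fs) (rf ∷ rfs) = begin
  n * (2 * k) + length fs * (n * (2 * k))
    ≤⟨ +-mono-≤ (weight-bound k δ G reg k≤δ f rf) (family-weight k δ G reg k≤δ fs rfs) ⟩
  (k + δ) * weight f + (k + δ) * sum (sumAt fs)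
    ≡⟨ sym (*-distribˡ-+ (k + δ) (weight f) (sum (sumAt fs))) ⟩
  (k + δ) * (weight f + sum (sumAt fs))
    ≡⟨ cong ((k + δ) *_) (sym (∑-distrib-+ (λ v → toℕ (f v)) (sumAt fs))) ⟩
  (k + δ) * sum (sumAt (f ∷ fs)) ∎
  where open ≤-Reasoning

-- if k ≤ δ, a Roman (k,k)-dominating family on a δ-regular graph of order ≥ 1
-- has at most k + δ members: its total weight is at most 2kn
large-degree-bound : ∀ {n} (k δ : ℕ) (G : Graph (suc n)) → Regular G δ → 1 ≤ k → k ≤ δ →
  (fs : List (Fin (suc n) → Fin 3)) → RkkFamily k G fs → length fs ≤ k + δ
large-degree-bound {n} (suc k) δ G reg (s≤s z≤n) k≤δ fs F =
  *-cancelʳ-≤ (length fs) (suc k + δ) (suc n * (2 * suc k)) (begin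
    length fs * (suc n * (2 * suc k))      ≤⟨ family-weight (suc k) δ G reg k≤δ fs (RkkFamily.each-RkDF F) ⟩
    (suc k + δ) * sum (sumAt fs)           ≤⟨ *-monoʳ-≤ (suc k + δ) (sum-mono (RkkFamily.bounded F)) ⟩
    (suc k + δ) * sum {suc n} (λ _ → 2 * suc k) ≡⟨ cong ((suc k + δ) *_) (sum-const {suc n} (2 * suc k)) ⟩
    (suc k + δ) * (suc n * (2 * suc k)) ∎)
  where open ≤-Reasoning

-- The case δ < k: every label is positive

Positive : ∀ {n} → (Fin n → Fin 3) → Set
Positive f = ∀ v → f v ≢ zero

-- if δ < k, no vertex of a δ-regular graph has k neighbours, so an RkDF has no 0
RkDF-positive : ∀ {n} (k δ : ℕ) (G : Graph n) → Regular G δ → δ < k →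
  (f : Fin n → Fin 3) → RkDF k G f → Positive f
RkDF-positive k δ G reg δ<k f rf v fv≡0 = <⇒≱ δ<k (begin
  k                                        ≤⟨ rf v fv≡0 ⟩
  count (λ u → adj G v u ∧ is2 (f u))      ≤⟨ count-∧ (adj G v) (is2 ∘ f) ⟩
  degree G v                               ≡⟨ reg v ⟩
  δ ∎)
  where open ≤-Reasoning

length≤sumAt : ∀ {n} (v : Fin n) (fs : List (Fin n → Fin 3)) → All Positive fs →
  length fs ≤ sumAt fs v
length≤sumAt v []       []         = z≤n
length≤sumAt v (f ∷ fs) (pos ∷ ps) with f v in eq
... | zero  = ⊥-elim (pos v eq)
... | suc x = s≤s (≤-trans (length≤sumAt v fs ps) (m≤n+m _ (toℕ x)))

all-one : ∀ {n} (v : Fin n) (fs : List (Fin n → Fin 3)) → All Positive fs →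
  sumAt fs v ≤ length fs → All (λ f → f v ≡ suc zero) fs
all-one v []       []         _ = []
all-one v (f ∷ fs) (pos ∷ ps) s≤l with f v in eq
... | zero             = ⊥-elim (pos v eq)
... | suc zero         = eq ∷ all-one v fs ps (≤-pred s≤l)
... | suc (suc zero)   = ⊥-elim (<-irrefl refl (≤-trans (≤-pred s≤l) (length≤sumAt v fs ps)))

constant-one-family : ∀ {n} (fs : List (Fin n → Fin 3)) → AllPairs Distinct fs →
  (∀ v → All (λ f → f v ≡ suc zero) fs) → length fs ≤ 1
constant-one-family []            _                  _    = z≤n
constant-one-family (_ ∷ [])      _                  _    = s≤s z≤n
constant-one-family (f ∷ g ∷ _)   ((f≢g ∷ _) ∷ _)    ones = ⊥-elim (f≢g agree)
  where
  agree : ∀ v → f v ≡ g v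
  agree v with ones v
  ... | fv≡1 ∷ gv≡1 ∷ _ = trans fv≡1 (sym gv≡1)

-- pairwise distinct positive labellings with Σ_i f_i(v) ≤ m everywhere number
-- fewer than m (when m ≥ 2): with m or more of them, all would be constantly 1
positive-family-bound : ∀ {n} (m : ℕ) → 2 ≤ m → (fs : List (Fin n → Fin 3)) →
  All Positive fs → AllPairs Distinct fs → (∀ v → sumAt fs v ≤ m) → length fs < m
positive-family-bound m 2≤m fs pos dist bounded with m ≤? length fs
... | no  m≰len = ≰⇒> m≰len
... | yes m≤len = ⊥-elim (≤⇒≯ (constant-one-family fs dist ones) (≤-trans 2≤m m≤len))
  where
  ones : ∀ v → All (λ f → f v ≡ suc zero) fs
  ones v = all-one v fs pos (≤-trans (bounded v) m≤len)

All-positive : ∀ {n} (k δ : ℕ) (G : Graph n) → Regular G δ → δ < k →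
  (fs : List (Fin n → Fin 3)) → All (RkDF k G) fs → All Positive fs
All-positive k δ G reg δ<k []       []         = []
All-positive k δ G reg δ<k (f ∷ fs) (rf ∷ rfs) =
  RkDF-positive k δ G reg δ<k f rf ∷ All-positive k δ G reg δ<k fs rfs

small-degree-bound : ∀ {n} (k δ : ℕ) (G : Graph n) → Regular G δ → 1 ≤ k → δ < k →
  (fs : List (Fin n → Fin 3)) → RkkFamily k G fs → length fs ≤ 2 * k ∸ 1
small-degree-bound (suc k) δ G reg (s≤s z≤n) δ<k fs F = <⇒≤pred
  (positive-family-bound (2 * suc k) (*-monoʳ-≤ 2 (s≤s z≤n)) fs
    (All-positive (suc k) δ G reg δ<k fs (RkkFamily.each-RkDF F))
    (RkkFamily.distinct F) (RkkFamily.bounded F))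

regular-domatic-bound : ∀ {n} (k δ : ℕ) (G : Graph (suc n)) → Regular G δ → 1 ≤ k →
  (fs : List (Fin (suc n) → Fin 3)) → RkkFamily k G fs →
  length fs ≤ (2 * k ∸ 1) ⊔ (k + δ)
regular-domatic-bound k δ G reg 1≤k fs F with k ≤? δ
... | yes k≤δ = ≤-trans (large-degree-bound k δ G reg 1≤k k≤δ fs F) (m≤n⊔m _ _)
... | no  k≰δ = ≤-trans (small-degree-bound k δ G reg 1≤k (≰⇒> k≰δ) fs F) (m≤m⊔n _ _)

-- on the empty vertex set all labellings coincide
empty-family-bound : (fs : List (Fin 0 → Fin 3)) → AllPairs Distinct fs → length fs ≤ 1
empty-family-bound fs dist = constant-one-family fs dist (λ ())

+-⊔-lub : ∀ {a b c d x : ℕ} → a + c ≤ x → a + d ≤ x → b + c ≤ x → b + d ≤ x →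
  (a ⊔ b) + (c ⊔ d) ≤ x
+-⊔-lub {a} {b} {c} {d} ac ad bc bd = subst (_≤ _) (sym expand) (⊔-lub (⊔-lub ac ad) (⊔-lub bc bd))
  where
  expand : (a ⊔ b) + (c ⊔ d) ≡ ((a + c) ⊔ (a + d)) ⊔ ((b + c) ⊔ (b + d))
  expand = trans (+-distribʳ-⊔ (c ⊔ d) a b) (cong₂ _⊔_ (+-distribˡ-⊔ a c d) (+-distribˡ-⊔ b c d))

≤-∸ : ∀ {x y} c → x + c ≡ y → x ≤ y ∸ c
≤-∸ {x} c eq = m+n≤o⇒m≤o∸n x (≤-reflexive eq)

sum-of-bounds : ∀ (k δ δ' n : ℕ) → 1 ≤ k → n ≡ δ' + (δ + 1) →
  ((2 * k ∸ 1) ⊔ (k + δ)) + ((2 * k ∸ 1) ⊔ (k + δ')) ≤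
    ((4 * k ∸ 2) ⊔ (n + 2 * k ∸ 1)) ⊔ ((n + 3 * k ∸ 2 ∸ δ) ⊔ (3 * k + δ ∸ 1))
sum-of-bounds (suc k) δ δ' _ (s≤s z≤n) refl = +-⊔-lub {2 * suc k ∸ 1} {suc k + δ} {2 * suc k ∸ 1} {suc k + δ'}
  (≤-trans (≤-∸ 2 (twice k)) (≤-trans (m≤m⊔n P Q) (m≤m⊔n (P ⊔ Q) (R ⊔ S))))
  (≤-trans (m+n≤o⇒m≤o∸n _ (≤-∸ 2 (once-complement k δ δ'))) (≤-trans (m≤m⊔n R S) (m≤n⊔m (P ⊔ Q) (R ⊔ S))))
  (≤-trans (≤-∸ 1 (once-graph k δ)) (≤-trans (m≤n⊔m R S) (m≤n⊔m (P ⊔ Q) (R ⊔ S))))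
  (≤-trans (≤-∸ 1 (both k δ δ')) (≤-trans (m≤n⊔m P Q) (m≤m⊔n (P ⊔ Q) (R ⊔ S))))
  where
  n P Q R S : ℕ
  n = δ' + (δ + 1)
  P = 4 * suc k ∸ 2
  Q = n + 2 * suc k ∸ 1
  R = n + 3 * suc k ∸ 2 ∸ δ
  S = 3 * suc k + δ ∸ 1
  -- 2 * suc k ∸ 1 unfolds to k + 1 * suc k, a form the ring solver accepts
  twice : ∀ k → (k + 1 * suc k) + (k + 1 * suc k) + 2 ≡ 4 * suc k
  twice = solve-∀
  once-complement : ∀ k δ δ' → (k + 1 * suc k) + (suc k + δ') + δ + 2 ≡ δ' + (δ + 1) + 3 * suc k
  once-complement = solve-∀
  once-graph : ∀ k δ → (suc k + δ) + (k + 1 * suc k) + 1 ≡ 3 * suc k + δ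
  once-graph = solve-∀
  both : ∀ k δ δ' → (suc k + δ) + (suc k + δ') + 1 ≡ δ' + (δ + 1) + 2 * suc k
  both = solve-∀

theorem8 : (k : ℕ) → 1 ≤ k → (n δ : ℕ) → (G : Graph n) → Regular G δ →
    (fs gs : List (Fin n → Fin 3)) →
    RkkFamily k G fs → RkkFamily k (complement G) gs →
    length fs + length gs ≤
      ((4 * k ∸ 2) ⊔ (n + 2 * k ∸ 1)) ⊔ ((n + 3 * k ∸ 2 ∸ δ) ⊔ (3 * k + δ ∸ 1))
-- no vertices: both families have at most one member, and 1 + 1 ≤ 4k − 2
theorem8 k 1≤k zero δ G reg fs gs F H = begin
  length fs + length gs ≤⟨ +-mono-≤ (empty-family-bound fs (RkkFamily.distinct F))
                                    (empty-family-bound gs (RkkFamily.distinct H)) ⟩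
  2                     ≤⟨ m+n≤o⇒m≤o∸n 2 (*-monoʳ-≤ 4 1≤k) ⟩
  4 * k ∸ 2             ≤⟨ ≤-trans (m≤m⊔n _ _) (m≤m⊔n _ _) ⟩
  _ ∎
  where open ≤-Reasoning
theorem8 k 1≤k (suc n) δ G reg fs gs F H = ≤-trans
  (+-mono-≤ (regular-domatic-bound k δ G reg 1≤k fs F)
            (regular-domatic-bound k δ' (complement G) (complement-regular G δ reg) 1≤k gs H))
  (sum-of-bounds k δ δ' (suc n) 1≤k (regular-order G δ reg))
  where
  δ' : ℕ
  δ' = suc n ∸ (δ + 1)
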